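{- The maximum number of nonzero entries in an $n\times n\times n$ alternating sign hypermatrix (ASHM) is $m_n=\frac{n(n^2+2)}{3}$, and this maximum is attained by the diamond ASHM $\mathfrak D_n=[F_n^1,F_n^2,\ldots,F_n^n]$. Moreover, for each $k\in\{1,\dots,n\}$: (i) $F_n^k$ has the largest number of nonzeros among all $n\times n$ ASMs $A$ for which there exist ASMs $A_1,\dots,A_{k-1},A_{k+1},\dots,A_n$ such that $[A_1,\dots,A_{k-1},A,A_{k+1},\dots,A_n]$ is an ASHM; (ii) more generally, for such an $A$, the number of nonzeros in each row (resp. column) of $A$ is at most the number of nonzeros in the corresponding row (resp. column) of $F_n^k$.
   Context: An $n\times n$ alternating sign matrix (ASM) is a $(0,\pm1)$-matrix in which, in every row and column, the nonzeros alternate in sign beginning and ending with $+1$. For an $n\times n\times n$ $(0,\pm1)$-hypermatrix $A=[a_{ijk}]$ with horizontal planes $A_k=[a_{ijk}]_{i,j}$ we write $A=[A_1,\dots,A_n]$; $A$ is an alternating sign hypermatrix (ASHM) if every line (fix two indices, vary the third) has nonzeros alternating in sign beginning and ending with $+1$, equivalently every plane obtained by fixing one index is an ASM. For $1\le k\le n$, $F_n^k=[f_{ij}]$ is the $n\times n$ matrix with $f_{ij}=(-1)^{i+j-k-1}$ if $k+1\le i+j\le 2n-k+1$ and $|i-j|\le k-1$, and $f_{ij}=0$ otherwise (so $F_n^1=I_n$ and $F_n^n$ is the anti-diagonal permutation matrix); each $F_n^k$ is an ASM, and $\mathfrak D_n=[F_n^1,\dots,F_n^n]$ is an ASHM. 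-}

module Defs where

open import Data.Nat using (ℕ; zero; suc; _+_; _*_; _∸_; _≤ᵇ_; ∣_-_∣)
open import Data.Bool using (Bool; true; false; if_then_else_; _∧_)
open import Data.Integer using (ℤ; +_; -[1+_]; -_; _^_)
open import Data.Fin using (Fin; toℕ)
open import Data.List using (List; []; _∷_; map)
open import Data.Nat.ListAction using (sum)
open import Data.Vec.Functional using (Vector; toList)
open import Data.Sum using (_⊎_)
open import Data.Unit using (⊤)
open import Data.Empty using (⊥)
open import Data.Product using (_×_)
open import Relation.Binary.PropositionalEquality using (_≡_)

Matrix : ℕ → Set
Matrix n = Fin n → Fin n → ℤ

-- a i j k  (the k-th horizontal plane is  A_k = [a i j k]_{i,j})
Hypermatrix : ℕ → Set
Hypermatrix n = Fin n → Fin n → Fin n → ℤ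

IsSignEntry : ℤ → Set
IsSignEntry x = x ≡ + 0 ⊎ (x ≡ + 1 ⊎ x ≡ -[1+ 0 ])

nonzeros : List ℤ → List ℤ
nonzeros [] = []
nonzeros (+ zero ∷ xs) = nonzeros xs
nonzeros (x ∷ xs) = x ∷ nonzeros xs

AltPM : List ℤ → Set
AltPM [] = ⊥
AltPM (x ∷ []) = x ≡ + 1
AltPM (x ∷ y ∷ rest) = x ≡ + 1 × (y ≡ -[1+ 0 ] × AltPM rest)

AltLine : {n : ℕ} → Vector ℤ n → Set
AltLine v = AltPM (nonzeros (toList v))

nnzLine : {n : ℕ} → Vector ℤ n → ℕ
nnzLine v = Data.List.length (nonzeros (toList v))
  where import Data.List

IsASM : (n : ℕ) → Matrix n → Set
IsASM n A =
  (∀ i j → IsSignEntry (A i j)) ×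
  ((∀ i → AltLine (λ j → A i j)) ×
   (∀ j → AltLine (λ i → A i j)))

IsASHM : (n : ℕ) → Hypermatrix n → Set
IsASHM n A =
  (∀ i j k → IsSignEntry (A i j k)) ×
  ((∀ j k → AltLine (λ i → A i j k)) ×
   ((∀ i k → AltLine (λ j → A i j k)) ×
    (∀ i j → AltLine (λ k → A i j k))))

nnzMatrix : (n : ℕ) → Matrix n → ℕ
nnzMatrix n A = sum (toList (λ i → nnzLine (λ j → A i j)))

nnzHyper : (n : ℕ) → Hypermatrix n → ℕ
nnzHyper n A = sum (toList (λ k → nnzMatrix n (λ i j → A i j k)))

-- entry (i,j) of F_n^k, with 1-based i j k:
-- (-1)^(i+j-k-1) if k+1 ≤ i+j ≤ 2n-k+1 and |i-j| ≤ k-1, else 0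
fEntry : (n k i j : ℕ) → ℤ
fEntry n k i j =
  if ((k + 1 ≤ᵇ i + j) ∧ (i + j ≤ᵇ (2 * n ∸ k) + 1)) ∧ (∣ i - j ∣ ≤ᵇ k ∸ 1)
  then (- + 1) ^ (i + j ∸ k ∸ 1)
  else + 0

F : (n : ℕ) → Fin n → Matrix n
F n k i j = fEntry n (suc (toℕ k)) (suc (toℕ i)) (suc (toℕ j))

Diamond : (n : ℕ) → Hypermatrix n
Diamond n i j k = F n k i j

ExtendsAt : (n : ℕ) → Fin n → Matrix n → Set
ExtendsAt n k A = Data.Product.∃ (λ (H : Hypermatrix n) → IsASHM n H × (∀ i j → H i j k ≡ A i j))
  where import Data.Product

module Submission where

-- In an ASM the column partial sums above any row lie in {0, 1} and every row
-- sums to 1.  Summing the entrywise inequalities [a ≠ 0] ≤ a + 2s and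
-- [a ≠ 0] + 2(s + a) ≤ a + 2 (s the column partial sum above the entry a) along row i
-- (0-based) gives at most 2·depth(i) + 1 nonzeros, depth(i) = min(i, n - 1 - i).  A line of
-- an ASHM is a row of two of its planes, both ASMs, so the line with fixed coordinates p, q
-- has at most lineBound n p q = 2·min(depth p, depth q) + 1 nonzeros.
--
-- The entry of 𝔇_n at (p, q, r) is (-1)^(p+q+r) if p, q, r satisfy the triangle
-- inequalities and p + q + r ≤ 2n - 2, and 0 otherwise.  This description is symmetric in
-- the coordinates and puts on every line a window of exactly lineBound n p q alternating
-- ±1's, so 𝔇_n is an ASHM, each F_n^k is an ASM, and every line meets its bound.
--
-- Counting.  Σ_{i,k} lineBound n i k = n(n² + 2)/3, by peeling off the border (n ↦ n + 2).

open import Defs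
open import Data.Nat using (ℕ; _+_; _*_; _≤_)
open import Data.Nat.DivMod using (_/_)
open import Data.Nat.DivMod using (m*n/n≡m)
open import Data.Fin using (Fin)
open import Data.Product using (_×_)
open import Relation.Binary.PropositionalEquality using (_≡_)

open import Data.Nat using (zero; suc; _∸_; _⊓_; _<_; z≤n; s≤s; s≤s⁻¹; _≤ᵇ_; ∣_-_∣)
import Data.Nat.Properties as ℕP
open import Data.Integer as ℤ using (ℤ; +_; -[1+_])
import Data.Integer.Properties as ℤP
open import Algebra.Properties.CommutativeSemigroup ℤP.+-commutativeSemigroup using () renaming (interchange to ℤ-+-interchange)
open import Algebra.Properties.CommutativeSemigroup ℕP.+-commutativeSemigroup using () renaming (interchange to ℕ-+-interchange)
open import Data.Fin using (toℕ; zero; suc)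
open import Data.Fin.Properties using (toℕ<n)
open import Data.List using (List; []; _∷_; _++_; length)
open import Data.List.Properties using (++-identityʳ; tabulate-cong)
open import Data.Vec.Functional using (toList)
open import Data.Nat.ListAction using (sum)
open import Data.Product using (_,_; proj₁; proj₂)
open import Data.Sum using (_⊎_; inj₁; inj₂)
open import Data.Unit using (⊤; tt)
open import Data.Empty using (⊥-elim)
open import Relation.Nullary using (¬_; Dec; yes; no; _×-dec_)
open import Data.Bool using (Bool; true; false; T; _∧_; if_then_else_)
open import Data.Bool.Properties using (T-∧)
open import Function.Bundles using (_⇔_; mk⇔; module Equivalence)
open import Relation.Binary.PropositionalEquality using (refl; sym; trans; cong; cong₂; subst; subst₂; module ≡-Reasoning)

sign : ℕ → ℤ
sign zero = + 1
sign (suc zero) = -[1+ 0 ]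
sign (suc (suc t)) = sign t

sign-unit : ∀ t → sign t ≡ + 1 ⊎ sign t ≡ -[1+ 0 ]
sign-unit zero = inj₁ refl
sign-unit (suc zero) = inj₂ refl
sign-unit (suc (suc t)) = sign-unit t

sign-+-even : ∀ k t → sign ((k + k) + t) ≡ sign t
sign-+-even zero t = refl
sign-+-even (suc k) t rewrite ℕP.+-suc k k = sign-+-even k t

sign-pow : ∀ t → (ℤ.- + 1) ℤ.^ t ≡ sign t
sign-pow zero = refl
sign-pow (suc zero) = refl
sign-pow (suc (suc t)) =
  trans (sym (ℤP.*-assoc -[1+ 0 ] -[1+ 0 ] _)) (trans (ℤP.*-identityˡ _) (sign-pow t))

-- segment g a c = g a ∷ g (a + 1) ∷ … ∷ g (a + c - 1): the lines of all matrices below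
-- are read as segments of sequences ℕ → ℤ indexed by the varying coordinate
segment : (ℕ → ℤ) → ℕ → ℕ → List ℤ
segment g a zero = []
segment g a (suc c) = g a ∷ segment g (suc a) c

segment-shift : ∀ g a c → segment (λ x → g (suc x)) a c ≡ segment g (suc a) c
segment-shift g a zero = refl
segment-shift g a (suc c) = cong (g (suc a) ∷_) (segment-shift g (suc a) c)

toList-segment : ∀ n (g : ℕ → ℤ) → toList (λ (r : Fin n) → g (toℕ r)) ≡ segment g 0 n
toList-segment zero g = refl
toList-segment (suc n) g =
  cong (g 0 ∷_) (trans (toList-segment n (λ x → g (suc x))) (segment-shift g 0 n))

segment-++ : ∀ g a x y → segment g a (x + y) ≡ segment g a x ++ segment g (a + x) y
segment-++ g a zero y rewrite ℕP.+-identityʳ a = refl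
segment-++ g a (suc x) y rewrite ℕP.+-suc a x = cong (g a ∷_) (segment-++ g (suc a) x y)

length-segment : ∀ g a c → length (segment g a c) ≡ c
length-segment g a zero = refl
length-segment g a (suc c) = cong suc (length-segment g (suc a) c)

nonzeros-++ : ∀ xs ys → nonzeros (xs ++ ys) ≡ nonzeros xs ++ nonzeros ys
nonzeros-++ [] ys = refl
nonzeros-++ (+ zero ∷ xs) ys = nonzeros-++ xs ys
nonzeros-++ (+ suc n ∷ xs) ys = cong (+ suc n ∷_) (nonzeros-++ xs ys)
nonzeros-++ (-[1+ n ] ∷ xs) ys = cong (-[1+ n ] ∷_) (nonzeros-++ xs ys)

segment-cong : ∀ g h a b c → (∀ t → t < c → g (a + t) ≡ h (b + t)) → segment g a c ≡ segment h b c
segment-cong g h a b zero eq = refl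
segment-cong g h a b (suc c) eq = cong₂ _∷_ first (segment-cong g h (suc a) (suc b) c rest)
  where
  first : g a ≡ h b
  first = subst₂ (λ x y → g x ≡ h y) (ℕP.+-identityʳ a) (ℕP.+-identityʳ b) (eq 0 (s≤s z≤n))
  rest : ∀ t → t < c → g (suc a + t) ≡ h (suc b + t)
  rest t t<c = subst₂ (λ x y → g x ≡ h y) (ℕP.+-suc a t) (ℕP.+-suc b t) (eq (suc t) (s≤s t<c))

nonzeros-zeros : ∀ b c → nonzeros (segment (λ _ → + 0) b c) ≡ []
nonzeros-zeros b zero = refl
nonzeros-zeros b (suc c) = nonzeros-zeros (suc b) c

nonzeros-unit : ∀ x xs → x ≡ + 1 ⊎ x ≡ -[1+ 0 ] → nonzeros (x ∷ xs) ≡ x ∷ nonzeros xs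
nonzeros-unit .(+ 1) xs (inj₁ refl) = refl
nonzeros-unit .(-[1+ 0 ]) xs (inj₂ refl) = refl

nonzeros-signs : ∀ b c → nonzeros (segment sign b c) ≡ segment sign b c
nonzeros-signs b zero = refl
nonzeros-signs b (suc c) =
  trans (nonzeros-unit (sign b) _ (sign-unit b)) (cong (sign b ∷_) (nonzeros-signs (suc b) c))

segment-sign-periodic : ∀ a c → segment sign (suc (suc a)) c ≡ segment sign a c
segment-sign-periodic a zero = refl
segment-sign-periodic a (suc c) = cong (sign a ∷_) (segment-sign-periodic (suc a) c)

signs-alternating : ∀ m → AltPM (segment sign 0 (suc (m + m)))
signs-alternating zero = refl
signs-alternating (suc m) rewrite ℕP.+-suc m m | segment-sign-periodic 0 (suc (m + m)) =
  refl , refl , signs-alternating m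

window-nonzeros : ∀ g a L N → a + L < N →
  (∀ r → r < N → ¬ (a ≤ r × r ≤ a + L) → g r ≡ + 0) →
  (∀ t → t ≤ L → g (a + t) ≡ sign t) →
  nonzeros (segment g 0 N) ≡ segment sign 0 (suc L)
window-nonzeros g a L N a+L<N outside inside = begin
  nonzeros (segment g 0 N)
    ≡⟨ cong (λ x → nonzeros (segment g 0 x)) N-split ⟩
  nonzeros (segment g 0 (a + (suc L + rest)))
    ≡⟨ cong nonzeros (trans (segment-++ g 0 a _) (cong (segment g 0 a ++_) (segment-++ g a (suc L) rest))) ⟩
  nonzeros (segment g 0 a ++ (segment g a (suc L) ++ segment g (a + suc L) rest))
    ≡⟨ trans (nonzeros-++ (segment g 0 a) _) (cong (nonzeros (segment g 0 a) ++_) (nonzeros-++ (segment g a (suc L)) _)) ⟩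
  nonzeros (segment g 0 a) ++ (nonzeros (segment g a (suc L)) ++ nonzeros (segment g (a + suc L) rest))
    ≡⟨ cong₂ (λ xs ys → xs ++ (ys ++ nonzeros (segment g (a + suc L) rest))) before within ⟩
  segment sign 0 (suc L) ++ nonzeros (segment g (a + suc L) rest)
    ≡⟨ trans (cong (segment sign 0 (suc L) ++_) after) (++-identityʳ _) ⟩
  segment sign 0 (suc L) ∎
  where
  open ≡-Reasoning
  rest : ℕ
  rest = N ∸ suc (a + L)
  N-split : N ≡ a + (suc L + rest)
  N-split = begin
    N                     ≡⟨ sym (ℕP.m+[n∸m]≡n a+L<N) ⟩
    suc (a + L) + rest    ≡⟨ cong (_+ rest) (sym (ℕP.+-suc a L)) ⟩
    a + suc L + rest      ≡⟨ ℕP.+-assoc a (suc L) rest ⟩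
    a + (suc L + rest)    ∎
  before : nonzeros (segment g 0 a) ≡ []
  before = trans (cong nonzeros (segment-cong g (λ _ → + 0) 0 0 a vanish)) (nonzeros-zeros 0 a)
    where
    vanish : ∀ t → t < a → g t ≡ + 0
    vanish t t<a = outside t (ℕP.<-≤-trans t<a (ℕP.≤-trans (ℕP.m≤m+n a L) (ℕP.<⇒≤ a+L<N)))
                     (λ (a≤t , _) → ℕP.<⇒≱ t<a a≤t)
  within : nonzeros (segment g a (suc L)) ≡ segment sign 0 (suc L)
  within = trans (cong nonzeros (segment-cong g sign a 0 (suc L) (λ t t≤L → inside t (s≤s⁻¹ t≤L))))
                 (nonzeros-signs 0 (suc L))
  after : nonzeros (segment g (a + suc L) rest) ≡ []
  after = trans (cong nonzeros (segment-cong g (λ _ → + 0) (a + suc L) 0 rest vanish)) (nonzeros-zeros 0 rest)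
    where
    vanish : ∀ t → t < rest → g (a + suc L + t) ≡ + 0
    vanish t t<rest = outside _ (subst (a + suc L + t <_) (sym N-split') (ℕP.+-monoʳ-< (a + suc L) t<rest))
                        (λ (_ , r≤a+L) → ℕP.<⇒≱ (ℕP.<-≤-trans a+L<a+1+L (ℕP.m≤m+n _ t)) r≤a+L)
      where
      N-split' : N ≡ a + suc L + rest
      N-split' = trans N-split (sym (ℕP.+-assoc a (suc L) rest))
      a+L<a+1+L : a + L < a + suc L
      a+L<a+1+L = ℕP.+-monoʳ-< a (ℕP.n<1+n L)

Bit : ℤ → Set
Bit s = s ≡ + 0 ⊎ s ≡ + 1

PrefixBits : ℤ → List ℤ → Set
PrefixBits s [] = Bit s
PrefixBits s (x ∷ xs) = Bit s × PrefixBits (s ℤ.+ x) xs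

PrefixBits-start : ∀ s xs → PrefixBits s xs → Bit s
PrefixBits-start s [] bits = bits
PrefixBits-start s (x ∷ xs) bits = proj₁ bits

sumℤ : List ℤ → ℤ
sumℤ [] = + 0
sumℤ (x ∷ xs) = x ℤ.+ sumℤ xs

AltTail : List ℤ → Set
AltTail [] = ⊤
AltTail (x ∷ xs) = x ≡ -[1+ 0 ] × AltPM xs

AltPM-uncons : ∀ x xs → AltPM (x ∷ xs) → x ≡ + 1 × AltTail xs
AltPM-uncons x [] x≡1 = x≡1 , tt
AltPM-uncons x (y ∷ xs) alt = alt

alternating-sums : ∀ xs → AltPM (nonzeros xs) → PrefixBits (+ 0) xs × sumℤ xs ≡ + 1
altTail-sums : ∀ xs → AltTail (nonzeros xs) → PrefixBits (+ 1) xs × sumℤ xs ≡ + 0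
alternating-sums [] ()
alternating-sums (+ zero ∷ xs) alt with alternating-sums xs alt
... | bits , total rewrite total = (inj₁ refl , bits) , refl
alternating-sums (+ suc m ∷ xs) alt with AltPM-uncons _ _ alt
alternating-sums (+ suc zero ∷ xs) alt | refl , tail with altTail-sums xs tail
... | bits , total rewrite total = (inj₁ refl , bits) , refl
alternating-sums (-[1+ m ] ∷ xs) alt with AltPM-uncons _ _ alt
... | () , _
altTail-sums [] tt = inj₂ refl , refl
altTail-sums (+ zero ∷ xs) tail with altTail-sums xs tail
... | bits , total rewrite total = (inj₂ refl , bits) , refl
altTail-sums (+ suc m ∷ xs) (() , _)
altTail-sums (-[1+ zero ] ∷ xs) (refl , alt) with alternating-sums xs alt
... | bits , total rewrite total = (inj₂ refl , bits) , refl

isNonzero : ℤ → ℕ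
isNonzero (+ zero) = 0
isNonzero _ = 1

entry-bounds : ∀ s a → IsSignEntry a → Bit s → Bit (s ℤ.+ a) →
  (+ isNonzero a ℤ.≤ a ℤ.+ (s ℤ.+ s)) × (+ isNonzero a ℤ.+ ((s ℤ.+ a) ℤ.+ (s ℤ.+ a)) ℤ.≤ a ℤ.+ + 2)
entry-bounds .(+ 0) .(+ 0) (inj₁ refl) (inj₁ refl) _ = ℤ.+≤+ z≤n , ℤ.+≤+ z≤n
entry-bounds .(+ 0) .(+ 1) (inj₂ (inj₁ refl)) (inj₁ refl) _ = ℤ.+≤+ (s≤s z≤n) , ℤ.+≤+ (s≤s (s≤s (s≤s z≤n)))
entry-bounds .(+ 0) .(-[1+ 0 ]) (inj₂ (inj₂ refl)) (inj₁ refl) (inj₁ ())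
entry-bounds .(+ 0) .(-[1+ 0 ]) (inj₂ (inj₂ refl)) (inj₁ refl) (inj₂ ())
entry-bounds .(+ 1) .(+ 0) (inj₁ refl) (inj₂ refl) _ = ℤ.+≤+ z≤n , ℤ.+≤+ (s≤s (s≤s z≤n))
entry-bounds .(+ 1) .(+ 1) (inj₂ (inj₁ refl)) (inj₂ refl) (inj₁ ())
entry-bounds .(+ 1) .(+ 1) (inj₂ (inj₁ refl)) (inj₂ refl) (inj₂ ())
entry-bounds .(+ 1) .(-[1+ 0 ]) (inj₂ (inj₂ refl)) (inj₂ refl) _ = ℤ.+≤+ (s≤s z≤n) , ℤ.+≤+ (s≤s z≤n)

Σ : ∀ {n} → (Fin n → ℤ) → ℤ
Σ v = sumℤ (toList v)

Σ-+ : ∀ n (f g : Fin n → ℤ) → Σ (λ j → f j ℤ.+ g j) ≡ Σ f ℤ.+ Σ g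
Σ-+ zero f g = refl
Σ-+ (suc n) f g rewrite Σ-+ n (λ j → f (suc j)) (λ j → g (suc j)) =
  ℤ-+-interchange (f zero) (g zero) (Σ (λ j → f (suc j))) (Σ (λ j → g (suc j)))

Σ-mono : ∀ n (f g : Fin n → ℤ) → (∀ j → f j ℤ.≤ g j) → Σ f ℤ.≤ Σ g
Σ-mono zero f g f≤g = ℤP.≤-refl
Σ-mono (suc n) f g f≤g = ℤP.+-mono-≤ (f≤g zero) (Σ-mono n _ _ (λ j → f≤g (suc j)))

Σ-const : ∀ n c → Σ {n} (λ _ → + c) ≡ + (n * c)
Σ-const zero c = refl
Σ-const (suc n) c = cong (ℤ._+_ (+ c)) (Σ-const n c)

Σ-isNonzero : ∀ n (v : Fin n → ℤ) → Σ (λ j → + isNonzero (v j)) ≡ + nnzLine v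
Σ-isNonzero zero v = refl
Σ-isNonzero (suc n) v with v zero
... | + zero = trans (ℤP.+-identityˡ _) (Σ-isNonzero n (λ j → v (suc j)))
... | + suc _ = cong (ℤ._+_ (+ 1)) (Σ-isNonzero n (λ j → v (suc j)))
... | -[1+ _ ] = cong (ℤ._+_ (+ 1)) (Σ-isNonzero n (λ j → v (suc j)))

-- RowBounds n k x : a row of an ASM with n columns and k rows above it, having x nonzeros,
-- satisfies x ≤ 2k + 1 and (counting from the bottom) x ≤ 2(n - 1 - k) + 1
RowBounds : ℕ → ℕ → ℕ → Set
RowBounds n k x = x ≤ suc (k + k) × x + (suc k + suc k) ≤ suc (n + n)

-- One row a (summing to 1), given the column partial sums S of the c rows above it:
-- summing the two entry-bounds over the columns gives the two row bounds.
row-bounds : ∀ n (a S : Fin n → ℤ) (c : ℕ) → (∀ j → IsSignEntry (a j)) →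
  Σ a ≡ + 1 → Σ S ≡ + c → (∀ j → Bit (S j)) → (∀ j → Bit (S j ℤ.+ a j)) →
  RowBounds n c (nnzLine a)
row-bounds n a S c signs rowSum aboveSum above below = fromTop , fromBottom
  where
  open ≡-Reasoning
  local : ∀ j → (+ isNonzero (a j) ℤ.≤ a j ℤ.+ (S j ℤ.+ S j)) ×
                (+ isNonzero (a j) ℤ.+ ((S j ℤ.+ a j) ℤ.+ (S j ℤ.+ a j)) ℤ.≤ a j ℤ.+ + 2)
  local j = entry-bounds (S j) (a j) (signs j) (above j) (below j)
  belowSum : Σ (λ j → S j ℤ.+ a j) ≡ + suc c
  belowSum = trans (Σ-+ n S a) (trans (cong₂ ℤ._+_ aboveSum rowSum) (cong +_ (ℕP.+-comm c 1)))
  fromTop : nnzLine a ≤ suc (c + c)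
  fromTop = ℤP.drop‿+≤+ (subst₂ ℤ._≤_ (Σ-isNonzero n a) total (Σ-mono n _ _ (λ j → proj₁ (local j))))
    where
    total : Σ (λ j → a j ℤ.+ (S j ℤ.+ S j)) ≡ + suc (c + c)
    total = begin
      Σ (λ j → a j ℤ.+ (S j ℤ.+ S j)) ≡⟨ Σ-+ n a _ ⟩
      Σ a ℤ.+ Σ (λ j → S j ℤ.+ S j)   ≡⟨ cong (ℤ._+_ (Σ a)) (Σ-+ n S S) ⟩
      Σ a ℤ.+ (Σ S ℤ.+ Σ S)           ≡⟨ cong₂ (λ x y → x ℤ.+ (y ℤ.+ y)) rowSum aboveSum ⟩
      + suc (c + c)                   ∎
  fromBottom : nnzLine a + (suc c + suc c) ≤ suc (n + n)
  fromBottom = ℤP.drop‿+≤+ (subst₂ ℤ._≤_ total bound (Σ-mono n _ _ (λ j → proj₂ (local j))))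
    where
    total : Σ (λ j → + isNonzero (a j) ℤ.+ ((S j ℤ.+ a j) ℤ.+ (S j ℤ.+ a j))) ≡ + (nnzLine a + (suc c + suc c))
    total = begin
      Σ (λ j → + isNonzero (a j) ℤ.+ ((S j ℤ.+ a j) ℤ.+ (S j ℤ.+ a j)))
        ≡⟨ Σ-+ n _ _ ⟩
      Σ (λ j → + isNonzero (a j)) ℤ.+ Σ (λ j → (S j ℤ.+ a j) ℤ.+ (S j ℤ.+ a j))
        ≡⟨ cong₂ ℤ._+_ (Σ-isNonzero n a) (trans (Σ-+ n _ _) (cong₂ ℤ._+_ belowSum belowSum)) ⟩
      + (nnzLine a + (suc c + suc c)) ∎
    bound : Σ (λ j → a j ℤ.+ + 2) ≡ + suc (n + n)
    bound = begin
      Σ (λ j → a j ℤ.+ + 2)    ≡⟨ Σ-+ n a _ ⟩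
      Σ a ℤ.+ Σ {n} (λ _ → + 2) ≡⟨ cong₂ ℤ._+_ rowSum (Σ-const n 2) ⟩
      + suc (n * 2)            ≡⟨ cong (λ x → + suc x) (ℕP.*-comm n 2) ⟩
      + suc (n + (n + 0))      ≡⟨ cong (λ x → + suc (n + x)) (ℕP.+-identityʳ n) ⟩
      + suc (n + n)            ∎

-- Row i is processed with the state accumulated over the c + i rows above it.
rows-bounds : ∀ n m (M : Fin m → Fin n → ℤ) (S : Fin n → ℤ) (c : ℕ) →
  (∀ i j → IsSignEntry (M i j)) → (∀ i → Σ (M i) ≡ + 1) → Σ S ≡ + c →
  (∀ j → PrefixBits (S j) (toList (λ i → M i j))) →
  ∀ i → RowBounds n (c + toℕ i) (nnzLine (M i))
rows-bounds n (suc m) M S c signs rowSum aboveSum columnBits zero =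
  subst (λ k → RowBounds n k (nnzLine (M zero))) (sym (ℕP.+-identityʳ c))
    (row-bounds n (M zero) S c (signs zero) (rowSum zero) aboveSum
      (λ j → proj₁ (columnBits j)) (λ j → PrefixBits-start _ _ (proj₂ (columnBits j))))
rows-bounds n (suc m) M S c signs rowSum aboveSum columnBits (suc i) =
  subst (λ k → RowBounds n k (nnzLine (M (suc i)))) (sym (ℕP.+-suc c (toℕ i)))
    (rows-bounds n m (λ i → M (suc i)) (λ j → S j ℤ.+ M zero j) (suc c)
      (λ i → signs (suc i)) (λ i → rowSum (suc i)) belowSum (λ j → proj₂ (columnBits j)) i)
  where
  belowSum : Σ (λ j → S j ℤ.+ M zero j) ≡ + suc c
  belowSum = trans (Σ-+ n S (M zero)) (trans (cong₂ ℤ._+_ aboveSum (rowSum zero)) (cong +_ (ℕP.+-comm c 1)))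

depth : ℕ → ℕ → ℕ
depth n i = i ⊓ (n ∸ suc i)

odd-bound-⊓ : ∀ x a b → x ≤ suc (a + a) → x ≤ suc (b + b) → x ≤ suc (a ⊓ b + a ⊓ b)
odd-bound-⊓ x a b x≤a x≤b with ℕP.⊓-sel a b
... | inj₁ a⊓b≡a rewrite a⊓b≡a = x≤a
... | inj₂ a⊓b≡b rewrite a⊓b≡b = x≤b

RowBounds⇒depth : ∀ n k x → k < n → RowBounds n k x → x ≤ suc (depth n k + depth n k)
RowBounds⇒depth n k x k<n (fromTop , fromBottom) = odd-bound-⊓ x k (n ∸ suc k) fromTop bottom
  where
  open import Data.Nat.Tactic.RingSolver using (solve-∀)
  b : ℕ
  b = n ∸ suc k
  n≡ : n ≡ suc k + b
  n≡ = sym (ℕP.m+[n∸m]≡n k<n)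
  rearrange : ∀ k b → suc (suc k + b + (suc k + b)) ≡ (suc k + suc k) + suc (b + b)
  rearrange = solve-∀
  bottom : x ≤ suc (b + b)
  bottom = ℕP.+-cancelˡ-≤ (suc k + suc k) x (suc (b + b))
    (subst₂ _≤_ (ℕP.+-comm x _) (trans (cong (λ m → suc (m + m)) n≡) (rearrange k b)) fromBottom)

asm-row-bound : ∀ n (M : Matrix n) → IsASM n M → ∀ i → nnzLine (M i) ≤ suc (depth n (toℕ i) + depth n (toℕ i))
asm-row-bound n M (signs , rows , columns) i =
  RowBounds⇒depth n (toℕ i) _ (toℕ<n i)
    (rows-bounds n n M (λ _ → + 0) 0 signs (λ i → proj₂ (alternating-sums (toList (M i)) (rows i)))
      (trans (Σ-const n 0) (cong +_ (ℕP.*-zeroʳ n))) (λ j → proj₁ (alternating-sums _ (columns j))) i)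

horizontal-plane : ∀ n (H : Hypermatrix n) → IsASHM n H → ∀ k → IsASM n (λ i j → H i j k)
horizontal-plane n H (signs , alongI , alongJ , alongK) k =
  (λ i j → signs i j k) , (λ i → alongJ i k) , (λ j → alongI j k)

row-plane : ∀ n (H : Hypermatrix n) → IsASHM n H → ∀ i → IsASM n (λ k j → H i j k)
row-plane n H (signs , alongI , alongJ , alongK) i =
  (λ k j → signs i j k) , (λ k → alongJ i k) , (λ j → alongK i j)

column-plane : ∀ n (H : Hypermatrix n) → IsASHM n H → ∀ j → IsASM n (λ k i → H i j k)
column-plane n H (signs , alongI , alongJ , alongK) j =
  (λ k i → signs i j k) , (λ k → alongI j k) , (λ i → alongK i j)

transpose-ASM : ∀ n (M : Matrix n) → IsASM n M → IsASM n (λ i j → M j i)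
transpose-ASM n M (signs , rows , columns) = (λ i j → signs j i) , columns , rows

lineBound : ℕ → ℕ → ℕ → ℕ
lineBound n p q = suc (depth n p ⊓ depth n q + depth n p ⊓ depth n q)

-- Line bound for ASHMs: a line lies in two planes, each an ASM in which it is a row, so
-- both ASM row bounds apply.
ashm-row-bound : ∀ n (H : Hypermatrix n) → IsASHM n H →
  ∀ i k → nnzLine (λ j → H i j k) ≤ lineBound n (toℕ i) (toℕ k)
ashm-row-bound n H ashm i k = odd-bound-⊓ _ (depth n (toℕ i)) (depth n (toℕ k))
  (asm-row-bound n _ (horizontal-plane n H ashm k) i)
  (asm-row-bound n _ (row-plane n H ashm i) k)

ashm-column-bound : ∀ n (H : Hypermatrix n) → IsASHM n H →
  ∀ j k → nnzLine (λ i → H i j k) ≤ lineBound n (toℕ j) (toℕ k)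
ashm-column-bound n H ashm j k = odd-bound-⊓ _ (depth n (toℕ j)) (depth n (toℕ k))
  (asm-row-bound n _ (transpose-ASM n _ (horizontal-plane n H ashm k)) j)
  (asm-row-bound n _ (column-plane n H ashm j) k)

InDiamond : ℕ → ℕ → ℕ → ℕ → Set
InDiamond n p q r = (r ≤ p + q) × (p ≤ q + r) × (q ≤ p + r) × (suc (suc (p + q + r)) ≤ n + n)

-- the Boolean test in the definition of F_n^{r+1} at the 1-based position (p + 1, q + 1)
diamondTest : ℕ → ℕ → ℕ → ℕ → Bool
diamondTest n p q r =
  ((suc r + 1 ≤ᵇ suc p + suc q) ∧ (suc p + suc q ≤ᵇ (2 * n ∸ suc r) + 1)) ∧ (∣ suc p - suc q ∣ ≤ᵇ r)

∣-∣≤⇔ : ∀ p q r → ∣ p - q ∣ ≤ r ⇔ (p ≤ q + r × q ≤ p + r)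
∣-∣≤⇔ zero q r = mk⇔ (λ q≤r → z≤n , q≤r) proj₂
∣-∣≤⇔ (suc p) zero r = mk⇔ (λ p≤r → p≤r , z≤n) proj₁
∣-∣≤⇔ (suc p) (suc q) r = mk⇔
  (λ le → let (p≤ , q≤) = Equivalence.to (∣-∣≤⇔ p q r) le in s≤s p≤ , s≤s q≤)
  (λ (p≤ , q≤) → Equivalence.from (∣-∣≤⇔ p q r) (s≤s⁻¹ p≤ , s≤s⁻¹ q≤))

lower-corner⇔ : ∀ p q r → (suc r + 1 ≤ suc p + suc q) ⇔ (r ≤ p + q)
lower-corner⇔ p q r = mk⇔
  (λ le → s≤s⁻¹ (s≤s⁻¹ (subst₂ _≤_ (cong suc (ℕP.+-comm r 1)) (ℕP.+-suc (suc p) q) le)))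
  (λ le → subst₂ _≤_ (cong suc (ℕP.+-comm 1 r)) (sym (ℕP.+-suc (suc p) q)) (s≤s (s≤s le)))

upper-corner⇔ : ∀ n p q r → r < n → (suc p + suc q ≤ (2 * n ∸ suc r) + 1) ⇔ (suc (suc (p + q + r)) ≤ n + n)
upper-corner⇔ n p q r r<n = mk⇔
  (λ le → subst₂ _≤_ (shiftL p q r) shiftR (ℕP.+-monoʳ-≤ r le))
  (λ le → ℕP.+-cancelˡ-≤ r _ _ (subst₂ _≤_ (sym (shiftL p q r)) (sym shiftR) le))
  where
  open import Data.Nat.Tactic.RingSolver using (solve-∀)
  shiftL : ∀ p q r → r + (suc p + suc q) ≡ suc (suc (p + q + r))
  shiftL = solve-∀
  shiftR : r + ((2 * n ∸ suc r) + 1) ≡ n + n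
  shiftR = begin
    r + ((2 * n ∸ suc r) + 1)  ≡⟨ trans (cong (_+_ r) (ℕP.+-comm _ 1)) (ℕP.+-suc r _) ⟩
    suc r + (2 * n ∸ suc r)    ≡⟨ ℕP.m+[n∸m]≡n (ℕP.≤-trans r<n (ℕP.m≤m+n n (n + 0))) ⟩
    n + (n + 0)                ≡⟨ cong (_+_ n) (ℕP.+-identityʳ n) ⟩
    n + n                      ∎
    where open ≡-Reasoning

diamondTest⇔ : ∀ n p q r → r < n → T (diamondTest n p q r) ⇔ InDiamond n p q r
diamondTest⇔ n p q r r<n = mk⇔ to from
  where
  to : T (diamondTest n p q r) → InDiamond n p q r
  to test with Equivalence.to T-∧ test
  ... | corners , test-abs with Equivalence.to T-∧ corners
  ...   | test-lower , test-upper =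
    let (p≤ , q≤) = Equivalence.to (∣-∣≤⇔ p q r) (ℕP.≤ᵇ⇒≤ _ _ test-abs) in
    Equivalence.to (lower-corner⇔ p q r) (ℕP.≤ᵇ⇒≤ _ _ test-lower) , p≤ , q≤ ,
    Equivalence.to (upper-corner⇔ n p q r r<n) (ℕP.≤ᵇ⇒≤ _ _ test-upper)
  from : InDiamond n p q r → T (diamondTest n p q r)
  from (r≤ , p≤ , q≤ , perimeter) = Equivalence.from T-∧
    ( Equivalence.from T-∧ ( ℕP.≤⇒≤ᵇ (Equivalence.from (lower-corner⇔ p q r) r≤)
                           , ℕP.≤⇒≤ᵇ (Equivalence.from (upper-corner⇔ n p q r r<n) perimeter))
    , ℕP.≤⇒≤ᵇ (Equivalence.from (∣-∣≤⇔ p q r) (p≤ , q≤)))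

if-T : ∀ {A : Set} b {x y : A} → T b → (if b then x else y) ≡ x
if-T true _ = refl

if-¬T : ∀ {A : Set} b {x y : A} → ¬ T b → (if b then x else y) ≡ y
if-¬T true ¬t = ⊥-elim (¬t tt)
if-¬T false _ = refl

exponent-sign : ∀ p q r → r ≤ p + q → (ℤ.- + 1) ℤ.^ (suc p + suc q ∸ suc r ∸ 1) ≡ sign (p + q + r)
exponent-sign p q r r≤p+q = begin
  (ℤ.- + 1) ℤ.^ (suc p + suc q ∸ suc r ∸ 1)  ≡⟨ sign-pow (suc p + suc q ∸ suc r ∸ 1) ⟩
  sign (suc p + suc q ∸ suc r ∸ 1)           ≡⟨ cong sign exponent ⟩
  sign (p + q ∸ r)                           ≡⟨ sign-+-even r _ ⟨
  sign (r + r + (p + q ∸ r))                 ≡⟨ cong sign parity ⟩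
  sign (p + q + r)                           ∎
  where
  open ≡-Reasoning
  exponent : suc p + suc q ∸ suc r ∸ 1 ≡ p + q ∸ r
  exponent = trans (cong (λ x → x ∸ r ∸ 1) (ℕP.+-suc p q)) (cong (_∸ 1) (ℕP.+-∸-assoc 1 r≤p+q))
  parity : r + r + (p + q ∸ r) ≡ p + q + r
  parity = begin
    r + r + (p + q ∸ r)    ≡⟨ ℕP.+-assoc r r _ ⟩
    r + (r + (p + q ∸ r))  ≡⟨ cong (_+_ r) (ℕP.m+[n∸m]≡n r≤p+q) ⟩
    r + (p + q)            ≡⟨ ℕP.+-comm r (p + q) ⟩
    p + q + r              ∎

dEntry : ℕ → ℕ → ℕ → ℕ → ℤ
dEntry n p q r = fEntry n (suc r) (suc p) (suc q)

dEntry-inside : ∀ n p q r → r < n → InDiamond n p q r → dEntry n p q r ≡ sign (p + q + r)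
dEntry-inside n p q r r<n inside =
  trans (if-T (diamondTest n p q r) (Equivalence.from (diamondTest⇔ n p q r r<n) inside))
        (exponent-sign p q r (proj₁ inside))

dEntry-outside : ∀ n p q r → r < n → ¬ InDiamond n p q r → dEntry n p q r ≡ + 0
dEntry-outside n p q r r<n outside =
  if-¬T (diamondTest n p q r) (λ test → outside (Equivalence.to (diamondTest⇔ n p q r r<n) test))

InDiamond? : ∀ n p q r → Dec (InDiamond n p q r)
InDiamond? n p q r =
  (r ℕP.≤? p + q) ×-dec (p ℕP.≤? q + r) ×-dec (q ℕP.≤? p + r) ×-dec (suc (suc (p + q + r)) ℕP.≤? n + n)

InDiamond-swap₁₂ : ∀ n p q r → InDiamond n p q r → InDiamond n q p r
InDiamond-swap₁₂ n p q r (r≤ , p≤ , q≤ , perimeter) =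
  subst (r ≤_) (ℕP.+-comm p q) r≤ , q≤ , p≤ ,
  subst (λ x → suc (suc (x + r)) ≤ n + n) (ℕP.+-comm p q) perimeter

InDiamond-swap₂₃ : ∀ n p q r → InDiamond n p q r → InDiamond n p r q
InDiamond-swap₂₃ n p q r (r≤ , p≤ , q≤ , perimeter) =
  q≤ , subst (p ≤_) (ℕP.+-comm q r) p≤ , r≤ ,
  subst (λ x → suc (suc x) ≤ n + n) (exchange p q r) perimeter
  where
  open import Data.Nat.Tactic.RingSolver using (solve-∀)
  exchange : ∀ p q r → p + q + r ≡ p + r + q
  exchange = solve-∀

-- An entry of 𝔇_n only depends on membership in the diamond and on the parity of the
-- coordinate sum, hence 𝔇_n is invariant under permutations of the coordinates.
dEntry-cong : ∀ n p q r p′ q′ r′ → r < n → r′ < n →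
  (InDiamond n p q r ⇔ InDiamond n p′ q′ r′) → p + q + r ≡ p′ + q′ + r′ →
  dEntry n p q r ≡ dEntry n p′ q′ r′
dEntry-cong n p q r p′ q′ r′ r<n r′<n same sums with InDiamond? n p q r
... | yes inside = begin
  dEntry n p q r           ≡⟨ dEntry-inside n p q r r<n inside ⟩
  sign (p + q + r)         ≡⟨ cong sign sums ⟩
  sign (p′ + q′ + r′)      ≡⟨ dEntry-inside n p′ q′ r′ r′<n (Equivalence.to same inside) ⟨
  dEntry n p′ q′ r′        ∎
  where open ≡-Reasoning
... | no outside = trans (dEntry-outside n p q r r<n outside)
  (sym (dEntry-outside n p′ q′ r′ r′<n (λ inside′ → outside (Equivalence.from same inside′))))

dEntry-swap₁₂ : ∀ n p q r → r < n → dEntry n p q r ≡ dEntry n q p r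
dEntry-swap₁₂ n p q r r<n = dEntry-cong n p q r q p r r<n r<n
  (mk⇔ (InDiamond-swap₁₂ n p q r) (InDiamond-swap₁₂ n q p r)) (cong (_+ r) (ℕP.+-comm p q))

dEntry-swap₂₃ : ∀ n p q r → q < n → r < n → dEntry n p q r ≡ dEntry n p r q
dEntry-swap₂₃ n p q r q<n r<n = dEntry-cong n p q r p r q r<n q<n
  (mk⇔ (InDiamond-swap₂₃ n p q r) (InDiamond-swap₂₃ n p r q))
  (trans (ℕP.+-assoc p q r) (trans (cong (_+_ p) (ℕP.+-comm q r)) (sym (ℕP.+-assoc p r q))))

InDiamond⇔window : ∀ p e f r →
  InDiamond (suc (p + e + f)) p (p + e) r ⇔ (e ≤ r × r ≤ e + (p ⊓ f + p ⊓ f))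
InDiamond⇔window p e f r = mk⇔ to from
  where
  open import Data.Nat.Tactic.RingSolver using (solve-∀)
  viaTriangle : ∀ p e → p + (p + e) ≡ e + (p + p)
  viaTriangle = solve-∀
  viaPerimeter : ∀ p e f → suc (p + e + f) + suc (p + e + f) ≡ suc (suc (p + (p + e))) + (e + (f + f))
  viaPerimeter = solve-∀
  to : InDiamond (suc (p + e + f)) p (p + e) r → e ≤ r × r ≤ e + (p ⊓ f + p ⊓ f)
  to (r≤ , _ , q≤ , perimeter) = ℕP.+-cancelˡ-≤ p e r q≤ , upper
    where
    upper : r ≤ e + (p ⊓ f + p ⊓ f)
    upper with ℕP.⊓-sel p f
    ... | inj₁ min≡p rewrite min≡p = subst (r ≤_) (viaTriangle p e) r≤
    ... | inj₂ min≡f rewrite min≡f = ℕP.+-cancelˡ-≤ (suc (suc (p + (p + e)))) r _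
                                     (subst (suc (suc (p + (p + e) + r)) ≤_) (viaPerimeter p e f) perimeter)
  from : e ≤ r × r ≤ e + (p ⊓ f + p ⊓ f) → InDiamond (suc (p + e + f)) p (p + e) r
  from (e≤r , r≤) =
    subst (r ≤_) (sym (viaTriangle p e))
      (ℕP.≤-trans r≤ (ℕP.+-monoʳ-≤ e (ℕP.+-mono-≤ (ℕP.m⊓n≤m p f) (ℕP.m⊓n≤m p f)))) ,
    ℕP.≤-trans (ℕP.m≤m+n p e) (ℕP.m≤m+n (p + e) r) ,
    ℕP.+-monoʳ-≤ p e≤r ,
    subst (suc (suc (p + (p + e) + r)) ≤_) (sym (viaPerimeter p e f))
      (ℕP.+-monoʳ-≤ (suc (suc (p + (p + e))))
        (ℕP.≤-trans r≤ (ℕP.+-monoʳ-≤ e (ℕP.+-mono-≤ (ℕP.m⊓n≤n p f) (ℕP.m⊓n≤n p f)))))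

depth-⊓ : ∀ p e f → depth (suc (p + e + f)) p ⊓ depth (suc (p + e + f)) (p + e) ≡ p ⊓ f
depth-⊓ p e f = begin
  (p ⊓ (p + e + f ∸ p)) ⊓ ((p + e) ⊓ (p + e + f ∸ (p + e)))
    ≡⟨ cong₂ (λ x y → (p ⊓ x) ⊓ ((p + e) ⊓ y)) afterP afterQ ⟩
  (p ⊓ (e + f)) ⊓ ((p + e) ⊓ f)
    ≡⟨ ℕP.≤-antisym (ℕP.⊓-glb (ℕP.≤-trans (ℕP.m⊓n≤m _ _) (ℕP.m⊓n≤m _ _)) (ℕP.≤-trans (ℕP.m⊓n≤n _ _) (ℕP.m⊓n≤n _ _)))
                    (ℕP.⊓-glb (ℕP.⊓-glb (ℕP.m⊓n≤m p f) (ℕP.≤-trans (ℕP.m⊓n≤n p f) (ℕP.m≤n+m f e)))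
                              (ℕP.⊓-glb (ℕP.≤-trans (ℕP.m⊓n≤m p f) (ℕP.m≤m+n p e)) (ℕP.m⊓n≤n p f))) ⟩
  p ⊓ f ∎
  where
  open ≡-Reasoning
  afterP : p + e + f ∸ p ≡ e + f
  afterP = trans (cong (_∸ p) (ℕP.+-assoc p e f)) (ℕP.m+n∸m≡n p (e + f))
  afterQ : p + e + f ∸ (p + e) ≡ f
  afterQ = ℕP.m+n∸m≡n (p + e) f

split-range : ∀ n p q → p ≤ q → q < n → n ≡ suc (p + (q ∸ p) + (n ∸ suc q))
split-range n p q p≤q q<n =
  trans (sym (ℕP.m+[n∸m]≡n q<n)) (cong (λ x → suc (x + (n ∸ suc q))) (sym (ℕP.m+[n∸m]≡n p≤q)))

line-nonzeros-ordered : ∀ n p q e f (g : ℕ → ℤ) → q ≡ p + e → n ≡ suc (p + e + f) →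
  (∀ r → r < n → g r ≡ dEntry n p q r) → nonzeros (segment g 0 n) ≡ segment sign 0 (lineBound n p q)
line-nonzeros-ordered .(suc (p + e + f)) p .(p + e) e f g refl refl line =
  trans (window-nonzeros g e (m + m) n window<n outside inside)
        (cong (λ x → segment sign 0 (suc (x + x))) (sym (depth-⊓ p e f)))
  where
  open import Data.Nat.Tactic.RingSolver using (solve-∀)
  n : ℕ
  n = suc (p + e + f)
  m : ℕ
  m = p ⊓ f
  window<n : e + (m + m) < n
  window<n = s≤s (subst (e + (m + m) ≤_) (rearrange p e f)
               (ℕP.+-monoʳ-≤ e (ℕP.+-mono-≤ (ℕP.m⊓n≤m p f) (ℕP.m⊓n≤n p f))))
    where
    rearrange : ∀ p e f → e + (p + f) ≡ p + e + f
    rearrange = solve-∀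
  outside : ∀ r → r < n → ¬ (e ≤ r × r ≤ e + (m + m)) → g r ≡ + 0
  outside r r<n notInWindow = trans (line r r<n)
    (dEntry-outside n p (p + e) r r<n (λ inside → notInWindow (Equivalence.to (InDiamond⇔window p e f r) inside)))
  inside : ∀ t → t ≤ m + m → g (e + t) ≡ sign t
  inside t t≤2m = begin
    g (e + t)                      ≡⟨ line (e + t) e+t<n ⟩
    dEntry n p (p + e) (e + t)     ≡⟨ dEntry-inside n p (p + e) (e + t) e+t<n diamond ⟩
    sign (p + (p + e) + (e + t))   ≡⟨ cong sign (regroup p e t) ⟩
    sign ((p + e) + (p + e) + t)   ≡⟨ sign-+-even (p + e) t ⟩
    sign t                         ∎
    where
    open ≡-Reasoning
    regroup : ∀ p e t → p + (p + e) + (e + t) ≡ (p + e) + (p + e) + t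
    regroup = solve-∀
    e+t<n : e + t < n
    e+t<n = ℕP.≤-<-trans (ℕP.+-monoʳ-≤ e t≤2m) window<n
    diamond : InDiamond n p (p + e) (e + t)
    diamond = Equivalence.from (InDiamond⇔window p e f (e + t)) (ℕP.m≤m+n e t , ℕP.+-monoʳ-≤ e t≤2m)

line-nonzeros : ∀ n p q (g : ℕ → ℤ) → p < n → q < n → (∀ r → r < n → g r ≡ dEntry n p q r) →
  nonzeros (segment g 0 n) ≡ segment sign 0 (lineBound n p q)
line-nonzeros n p q g p<n q<n line with ℕP.≤-total p q
... | inj₁ p≤q = line-nonzeros-ordered n p q (q ∸ p) (n ∸ suc q) g (sym (ℕP.m+[n∸m]≡n p≤q)) (split-range n p q p≤q q<n) line
... | inj₂ q≤p = subst (λ x → nonzeros (segment g 0 n) ≡ segment sign 0 (suc (x + x))) (ℕP.⊓-comm (depth n q) (depth n p))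
  (line-nonzeros-ordered n q p (p ∸ q) (n ∸ suc p) g (sym (ℕP.m+[n∸m]≡n q≤p)) (split-range n q p q≤p p<n)
    (λ r r<n → trans (line r r<n) (dEntry-swap₁₂ n p q r r<n)))

diamond-line : ∀ n p q (g : ℕ → ℤ) → p < n → q < n → (∀ r → r < n → g r ≡ dEntry n p q r) →
  AltLine (λ (r : Fin n) → g (toℕ r)) × nnzLine (λ (r : Fin n) → g (toℕ r)) ≡ lineBound n p q
diamond-line n p q g p<n q<n line rewrite toList-segment n g | line-nonzeros n p q g p<n q<n line =
  signs-alternating (depth n p ⊓ depth n q) , length-segment sign 0 _

dEntry-sign : ∀ n p q r → r < n → IsSignEntry (dEntry n p q r)
dEntry-sign n p q r r<n with InDiamond? n p q r
... | no outside = inj₁ (dEntry-outside n p q r r<n outside)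
... | yes inside = inj₂ (subst (λ x → x ≡ + 1 ⊎ x ≡ -[1+ 0 ]) (sym (dEntry-inside n p q r r<n inside))
                              (sign-unit (p + q + r)))

F-row : ∀ n (k i : Fin n) → AltLine (λ j → F n k i j) × nnzLine (λ j → F n k i j) ≡ lineBound n (toℕ i) (toℕ k)
F-row n k i = diamond-line n (toℕ i) (toℕ k) (λ x → dEntry n (toℕ i) x (toℕ k)) (toℕ<n i) (toℕ<n k)
  (λ x x<n → dEntry-swap₂₃ n (toℕ i) x (toℕ k) x<n (toℕ<n k))

F-column : ∀ n (k j : Fin n) → AltLine (λ i → F n k i j) × nnzLine (λ i → F n k i j) ≡ lineBound n (toℕ j) (toℕ k)
F-column n k j = diamond-line n (toℕ j) (toℕ k) (λ x → dEntry n x (toℕ j) (toℕ k)) (toℕ<n j) (toℕ<n k)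
  (λ x x<n → trans (dEntry-swap₁₂ n x (toℕ j) (toℕ k) (toℕ<n k)) (dEntry-swap₂₃ n (toℕ j) x (toℕ k) x<n (toℕ<n k)))

F-ASM : ∀ n k → IsASM n (F n k)
F-ASM n k = (λ i j → dEntry-sign n (toℕ i) (toℕ j) (toℕ k) (toℕ<n k)) ,
            (λ i → proj₁ (F-row n k i)) , (λ j → proj₁ (F-column n k j))

diamond-ASHM : ∀ n → IsASHM n (Diamond n)
diamond-ASHM n =
  (λ i j k → dEntry-sign n (toℕ i) (toℕ j) (toℕ k) (toℕ<n k)) ,
  (λ j k → proj₁ (F-column n k j)) , (λ i k → proj₁ (F-row n k i)) ,
  (λ i j → proj₁ (diamond-line n (toℕ i) (toℕ j) (dEntry n (toℕ i) (toℕ j)) (toℕ<n i) (toℕ<n j) (λ _ _ → refl)))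

Σℕ : ℕ → (ℕ → ℕ) → ℕ
Σℕ zero h = 0
Σℕ (suc n) h = h 0 + Σℕ n (λ p → h (suc p))

sum-toList : ∀ n h → sum (toList (λ (i : Fin n) → h (toℕ i))) ≡ Σℕ n h
sum-toList zero h = refl
sum-toList (suc n) h = cong (_+_ (h 0)) (sum-toList n (λ p → h (suc p)))

Σℕ-cong : ∀ n h h′ → (∀ p → p < n → h p ≡ h′ p) → Σℕ n h ≡ Σℕ n h′
Σℕ-cong zero h h′ eq = refl
Σℕ-cong (suc n) h h′ eq = cong₂ _+_ (eq 0 (s≤s z≤n)) (Σℕ-cong n _ _ (λ p p<n → eq (suc p) (s≤s p<n)))

Σℕ-+ : ∀ n h h′ → Σℕ n (λ p → h p + h′ p) ≡ Σℕ n h + Σℕ n h′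
Σℕ-+ zero h h′ = refl
Σℕ-+ (suc n) h h′ rewrite Σℕ-+ n (λ p → h (suc p)) (λ p → h′ (suc p)) =
  ℕ-+-interchange (h 0) (h′ 0) (Σℕ n (λ p → h (suc p))) (Σℕ n (λ p → h′ (suc p)))

Σℕ-const : ∀ n c → Σℕ n (λ _ → c) ≡ n * c
Σℕ-const zero c = refl
Σℕ-const (suc n) c = cong (_+_ c) (Σℕ-const n c)

Σℕ-ends : ∀ n h → Σℕ (suc (suc n)) h ≡ h 0 + Σℕ n (λ p → h (suc p)) + h (suc n)
Σℕ-ends n h = trans (cong (_+_ (h 0)) (last n (λ p → h (suc p)))) (sym (ℕP.+-assoc (h 0) _ _))
  where
  last : ∀ n h → Σℕ (suc n) h ≡ Σℕ n h + h n
  last zero h = ℕP.+-comm (h 0) 0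
  last (suc n) h = trans (cong (_+_ (h 0)) (last n (λ p → h (suc p)))) (sym (ℕP.+-assoc (h 0) _ _))

depth-last : ∀ n → depth (suc (suc n)) (suc n) ≡ 0
depth-last n = trans (cong (suc n ⊓_) (ℕP.n∸n≡0 n)) (ℕP.⊓-zeroʳ (suc n))

depth-inner : ∀ n p → p < n → depth (suc (suc n)) (suc p) ≡ suc (depth n p)
depth-inner n p p<n = cong (suc p ⊓_) (ℕP.+-∸-assoc 1 p<n)

lineBound-comm : ∀ n p q → lineBound n p q ≡ lineBound n q p
lineBound-comm n p q = cong (λ x → suc (x + x)) (ℕP.⊓-comm (depth n p) (depth n q))

lineBound-border : ∀ n p q → q ≡ 0 ⊎ q ≡ suc n → lineBound (suc (suc n)) p q ≡ 1
lineBound-border n p .0 (inj₁ refl) rewrite ℕP.⊓-zeroʳ (depth (suc (suc n)) p) = refl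
lineBound-border n p .(suc n) (inj₂ refl) rewrite depth-last n | ℕP.⊓-zeroʳ (depth (suc (suc n)) p) = refl

lineBound-inner : ∀ n p q → p < n → q < n → lineBound (suc (suc n)) (suc p) (suc q) ≡ 2 + lineBound n p q
lineBound-inner n p q p<n q<n rewrite depth-inner n p p<n | depth-inner n q q<n =
  cong (λ x → suc (suc x)) (ℕP.+-suc (depth n p ⊓ depth n q) _)

total : ℕ → ℕ
total n = Σℕ n (λ k → Σℕ n (λ i → lineBound n i k))

inner-plane : ∀ n k → k < n →
  Σℕ (suc (suc n)) (λ i → lineBound (suc (suc n)) i (suc k)) ≡ (2 + n * 2) + Σℕ n (λ i → lineBound n i k)
inner-plane n k k<n = begin
  Σℕ (suc (suc n)) (λ i → lineBound (suc (suc n)) i (suc k))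
    ≡⟨ Σℕ-ends n (λ i → lineBound (suc (suc n)) i (suc k)) ⟩
  1 + Σℕ n (λ i → lineBound (suc (suc n)) (suc i) (suc k)) + lineBound (suc (suc n)) (suc n) (suc k)
    ≡⟨ cong₂ (λ x y → 1 + x + y) (Σℕ-cong n _ _ (λ i i<n → lineBound-inner n i k i<n k<n)) lastRow ⟩
  1 + Σℕ n (λ i → 2 + lineBound n i k) + 1
    ≡⟨ cong (λ x → 1 + x + 1) (trans (Σℕ-+ n (λ _ → 2) _) (cong (_+ Σℕ n (λ i → lineBound n i k)) (Σℕ-const n 2))) ⟩
  1 + (n * 2 + Σℕ n (λ i → lineBound n i k)) + 1
    ≡⟨ regroup (n * 2) (Σℕ n (λ i → lineBound n i k)) ⟩
  (2 + n * 2) + Σℕ n (λ i → lineBound n i k) ∎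
  where
  open ≡-Reasoning
  open import Data.Nat.Tactic.RingSolver using (solve-∀)
  lastRow : lineBound (suc (suc n)) (suc n) (suc k) ≡ 1
  lastRow = trans (lineBound-comm (suc (suc n)) (suc n) (suc k)) (lineBound-border n (suc k) (suc n) (inj₂ refl))
  regroup : ∀ a b → 1 + (a + b) + 1 ≡ (2 + a) + b
  regroup = solve-∀

total-step : ∀ n → total (suc (suc n)) ≡ suc (suc n) + n * (2 + n * 2) + total n + suc (suc n)
total-step n = begin
  total (suc (suc n))
    ≡⟨ Σℕ-ends n (λ k → Σℕ N (λ i → lineBound N i k)) ⟩
  Σℕ N (λ i → lineBound N i 0) + Σℕ n (λ k → Σℕ N (λ i → lineBound N i (suc k))) + Σℕ N (λ i → lineBound N i (suc n))
    ≡⟨ cong₂ (λ x y → x + Σℕ n (λ k → Σℕ N (λ i → lineBound N i (suc k))) + y) (borderPlane 0 (inj₁ refl)) (borderPlane (suc n) (inj₂ refl)) ⟩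
  N * 1 + Σℕ n (λ k → Σℕ N (λ i → lineBound N i (suc k))) + N * 1
    ≡⟨ cong (λ x → N * 1 + x + N * 1) innerPlanes ⟩
  N * 1 + (n * (2 + n * 2) + total n) + N * 1
    ≡⟨ regroup N (n * (2 + n * 2)) (total n) ⟩
  N + n * (2 + n * 2) + total n + N ∎
  where
  open ≡-Reasoning
  open import Data.Nat.Tactic.RingSolver using (solve-∀)
  N : ℕ
  N = suc (suc n)
  borderPlane : ∀ k → k ≡ 0 ⊎ k ≡ suc n → Σℕ N (λ i → lineBound N i k) ≡ N * 1
  borderPlane k border = trans (Σℕ-cong N _ _ (λ i _ → lineBound-border n i k border)) (Σℕ-const N 1)
  innerPlanes : Σℕ n (λ k → Σℕ N (λ i → lineBound N i (suc k))) ≡ n * (2 + n * 2) + total n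
  innerPlanes = trans (Σℕ-cong n _ _ (λ k k<n → inner-plane n k k<n))
                      (trans (Σℕ-+ n (λ _ → 2 + n * 2) _) (cong (_+ total n) (Σℕ-const n (2 + n * 2))))
  regroup : ∀ a b c → a * 1 + (b + c) + a * 1 ≡ a + b + c + a
  regroup = solve-∀

total-closed : ∀ n → total n * 3 ≡ n * (n * n + 2)
total-closed zero = refl
total-closed (suc zero) = refl
total-closed (suc (suc n)) = begin
  total (suc (suc n)) * 3
    ≡⟨ cong (_* 3) (total-step n) ⟩
  (suc (suc n) + n * (2 + n * 2) + total n + suc (suc n)) * 3
    ≡⟨ expand n (total n) ⟩
  6 * n * n + 12 * n + 12 + total n * 3
    ≡⟨ cong (_+_ (6 * n * n + 12 * n + 12)) (total-closed n) ⟩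
  6 * n * n + 12 * n + 12 + n * (n * n + 2)
    ≡⟨ cube n ⟩
  suc (suc n) * (suc (suc n) * suc (suc n) + 2) ∎
  where
  open ≡-Reasoning
  open import Data.Nat.Tactic.RingSolver using (solve-∀)
  expand : ∀ n t → (suc (suc n) + n * (2 + n * 2) + t + suc (suc n)) * 3 ≡ 6 * n * n + 12 * n + 12 + t * 3
  expand = solve-∀
  cube : ∀ n → 6 * n * n + 12 * n + 12 + n * (n * n + 2) ≡ suc (suc n) * (suc (suc n) * suc (suc n) + 2)
  cube = solve-∀

total-formula : ∀ n → n * (n * n + 2) / 3 ≡ total n
total-formula n = trans (cong (_/ 3) (sym (total-closed n))) (m*n/n≡m (total n) 3)

sum-mono : ∀ n (f g : Fin n → ℕ) → (∀ i → f i ≤ g i) → sum (toList f) ≤ sum (toList g)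
sum-mono zero f g f≤g = z≤n
sum-mono (suc n) f g f≤g = ℕP.+-mono-≤ (f≤g zero) (sum-mono n _ _ (λ i → f≤g (suc i)))

nnzLine-cong : ∀ n (v w : Fin n → ℤ) → (∀ j → v j ≡ w j) → nnzLine v ≡ nnzLine w
nnzLine-cong n v w v≗w = cong (λ xs → length (nonzeros xs)) (tabulate-cong v≗w)

sum-lineBounds : ∀ n →
  sum (toList (λ (k : Fin n) → sum (toList (λ (i : Fin n) → lineBound n (toℕ i) (toℕ k))))) ≡ total n
sum-lineBounds n =
  trans (sum-toList n (λ k → sum (toList (λ (i : Fin n) → lineBound n (toℕ i) k))))
        (Σℕ-cong n _ _ (λ k _ → sum-toList n (λ i → lineBound n i k)))

ashm-nnz-bound : ∀ n (H : Hypermatrix n) → IsASHM n H → nnzHyper n H ≤ total n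
ashm-nnz-bound n H ashm = subst (nnzHyper n H ≤_) (sum-lineBounds n)
  (sum-mono n _ _ (λ k → sum-mono n _ _ (λ i → ashm-row-bound n H ashm i k)))

diamond-nnz : ∀ n → nnzHyper n (Diamond n) ≡ total n
diamond-nnz n = trans (cong sum (tabulate-cong (λ k → cong sum (tabulate-cong (λ i → proj₂ (F-row n k i))))))
                      (sum-lineBounds n)

plane-line-bounds : ∀ n k (A : Matrix n) → ExtendsAt n k A →
  ((i : Fin n) → nnzLine (λ j → A i j) ≤ nnzLine (λ j → F n k i j)) ×
  ((j : Fin n) → nnzLine (λ i → A i j) ≤ nnzLine (λ i → F n k i j))
plane-line-bounds n k A (H , ashm , plane≡A) =
  (λ i → subst₂ _≤_ (nnzLine-cong n _ _ (λ j → plane≡A i j)) (sym (proj₂ (F-row n k i)))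
                    (ashm-row-bound n H ashm i k)) ,
  (λ j → subst₂ _≤_ (nnzLine-cong n _ _ (λ i → plane≡A i j)) (sym (proj₂ (F-column n k j)))
                    (ashm-column-bound n H ashm j k))

theorem2p2 : (n : ℕ) →
    ((A : Hypermatrix n) → IsASHM n A → nnzHyper n A ≤ n * (n * n + 2) / 3) ×
    (IsASHM n (Diamond n) × nnzHyper n (Diamond n) ≡ n * (n * n + 2) / 3) ×
    ((k : Fin n) →
      (IsASM n (F n k) × ExtendsAt n k (F n k)) ×
      ((A : Matrix n) → IsASM n A → ExtendsAt n k A → nnzMatrix n A ≤ nnzMatrix n (F n k)) ×
      ((A : Matrix n) → IsASM n A → ExtendsAt n k A →
        ((i : Fin n) → nnzLine (λ j → A i j) ≤ nnzLine (λ j → F n k i j)) ×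
        ((j : Fin n) → nnzLine (λ i → A i j) ≤ nnzLine (λ i → F n k i j))))
theorem2p2 n =
  (λ H ashm → subst (nnzHyper n H ≤_) (sym (total-formula n)) (ashm-nnz-bound n H ashm)) ,
  (diamond-ASHM n , trans (diamond-nnz n) (sym (total-formula n))) ,
  λ k → (F-ASM n k , Diamond n , diamond-ASHM n , (λ i j → refl)) ,
        (λ A _ extends → sum-mono n _ _ (proj₁ (plane-line-bounds n k A extends))) ,
        (λ A _ extends → plane-line-bounds n k A extends)
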